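{- Let $n=3k-2$ with $k\geq 2$ an integer (so that $f_{n+2}$ is even), and let $S(n)=\langle f_n^2,f_{n+1}^2,f_{n+2}^2\rangle$. Then \[ \mathrm{Ap}(S(n),f_n^2) = \left\{ \lambda f_{n+1}^2 + \mu f_{n+2}^2 \mid (\lambda,\mu)\in (C_1 \times C_2) \setminus (C_3 \times C_4) \right\}, \] where $C_1=\{0,\dots,\frac{f_{n+2}}{2}-1\}$, $C_2=\{0,\dots,f_n-1\}$, $C_3=\{\frac{f_{n-1}}{2},\dots,\frac{f_{n+2}}{2}-1\}$, $C_4=\{\frac{f_{n-2}+f_n}{2},\dots,f_n-1\}$.
   Context: The Fibonacci numbers are defined by $f_0=0$, $f_1=1$, $f_k=f_{k-1}+f_{k-2}$ for $k\geq 2$. $\langle a_1,a_2,a_3\rangle$ denotes the set of all non-negative integer linear combinations of $a_1,a_2,a_3$; here it is a numerical semigroup (a submonoid of $(\mathbb{N},+)$ with finite complement). For a numerical semigroup $S$ and $m\in S\setminus\{0\}$, the Apéry set is $\mathrm{Ap}(S,m)=\{s\in S\mid s-m\notin S\}$. -}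

module Defs where

open import Data.Nat using (ℕ; zero; suc; _+_; _*_; _∸_; _≤_; _<_; ⌊_/2⌋)
open import Data.Product using (Σ; ∃; _×_; _,_)
open import Relation.Binary.PropositionalEquality using (_≡_)
open import Relation.Nullary using (¬_)

fib : ℕ → ℕ
fib zero = zero
fib (suc zero) = suc zero
fib (suc (suc k)) = fib (suc k) + fib k

InSemigroup3 : ℕ → ℕ → ℕ → ℕ → Set
InSemigroup3 a₁ a₂ a₃ s = ∃ λ x → ∃ λ y → ∃ λ z → s ≡ x * a₁ + y * a₂ + z * a₃

-- Apéry set Ap(⟨a₁,a₂,a₃⟩, m) = { s ∈ S | s - m ∉ S }
-- (s - m is an integer; it lies in S only if m ≤ s and the natural difference lies in S)
InApery3 : ℕ → ℕ → ℕ → ℕ → ℕ → Set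
InApery3 a₁ a₂ a₃ m s = InSemigroup3 a₁ a₂ a₃ s × ¬ (m ≤ s × InSemigroup3 a₁ a₂ a₃ (s ∸ m))

InRange : ℕ → ℕ → ℕ → Set
InRange lo hi x = lo ≤ x × x ≤ hi

sq : ℕ → ℕ
sq x = x * x

-- Write c₂ = r₁₂ + r₃₂ and c₃ = r₁₃ + r₂₃. If c₂ B = r₂₁ A + r₂₃ C and c₃ C = r₃₁ A + r₃₂ B with
-- r₂₁, r₃₁ > 0, then also r₁₂ B + r₁₃ C = (r₂₁ + r₃₁) A, and each of these three relations trades
-- B's and C's for a positive number of A's. Applying them until none applies rewrites any
-- x A + y B + z C with (y, z) in the L-shaped region
--   L = { (y, z) | y < c₂, z < c₃, not (r₁₂ ≤ y and r₁₃ ≤ z) },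
-- so Ap(⟨A, B, C⟩, A) ⊆ { y B + z C | (y, z) ∈ L }.
-- Conversely let y B + z C = t A + y′ B + z′ C with (y, z) ∈ L and t > 0. As A is coprime to B and
-- C, the difference (y − y′, z − z′) lies in the lattice of (u, v) with u B + v C ≡ 0 (mod A), which
-- has basis (c₂, −r₂₃), (−r₃₂, c₃) because c₂ c₃ = A + r₂₃ r₃₂. So y − y′ = p c₂ − q r₃₂ and
-- z − z′ = q c₃ − p r₂₃ with t = p r₂₁ + q r₃₁ > 0, and comparing p, q with each other and with 0
-- gives y ≥ c₂, or z ≥ c₃, or p = q > 0 and (y, z) in the removed corner.
-- For n = 3k − 2 let d = f_{n−2} and 2h = f_{n−1}; then f_n = d + 2h, f_{n+1} = d + 4h and
-- f_{n+2} = 2(d + 3h), and the squares A, B, C of these satisfy the relations above with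
-- r₁₂ = r₂₃ = h, r₁₃ = d + h, r₃₂ = f_n, r₂₁ = f_{n+2}/2 and r₃₁ = f_{n+1} + f_{n+2}.

module Submission where

open import Defs
open import Data.Nat using (ℕ; zero; suc; _+_; _*_; _∸_; _≤_; _<_; ⌊_/2⌋; z≤n; s≤s; z<s; s<s; _≤?_; NonZero; >-nonZero; >-nonZero⁻¹)
open import Data.Nat.Properties
open import Data.Nat.Divisibility using (_∣_; divides; ∣-trans; _∣0; ∣m∣n⇒∣m+n; m∣m*n)
open import Data.Nat.Coprimality using (Coprime; coprime-divisor; coprime-+; 1-coprimeTo) renaming (sym to coprime-sym)
open import Data.Nat.Induction using (<-wellFounded)
open import Data.Nat.Tactic.RingSolver using (solve)
open import Data.List using (_∷_; [])
open import Data.Product using (∃; _×_; _,_; proj₂)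
open import Data.Sum using (_⊎_; inj₁; inj₂)
open import Data.Empty using (⊥; ⊥-elim)
open import Function.Bundles using (_⇔_; mk⇔; Equivalence)
open import Function.Construct.Composition using (_⇔-∘_)
open import Induction.WellFounded using (Acc; acc)
open import Relation.Binary.PropositionalEquality
open import Relation.Binary.Definitions using (tri<; tri≈; tri>)
open import Relation.Nullary using (¬_; yes; no)
open import Relation.Nullary.Decidable using (_×-dec_)

private
  variable
    c k l l′ m u u′ v v′ y y′ P₁ P₂ Q₁ Q₂ : ℕ

-- u ≡ u′ (mod m), with the integer (u − u′)/m = p⁺ − p⁻ written in normal form.
Congruent : ℕ → ℕ → ℕ → Set
Congruent m u u′ = ∃ λ p⁺ → ∃ λ p⁻ → (p⁺ ≡ 0 ⊎ p⁻ ≡ 0) × u + p⁻ * m ≡ u′ + p⁺ * m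

coprime-cancel-≤ : Coprime m k → u′ ≤ u → k * u + m * v ≡ k * u′ + m * v′ → ∃ λ p → u ≡ u′ + p * m
coprime-cancel-≤ {m} {k} {u′} {u} {v} {v′} m⊥k u′≤u eq with m≤n⇒∃[o]m+o≡n u′≤u
... | δ , refl with coprime-divisor m⊥k (divides (v′ ∸ v) kδ≡[v′∸v]m)
  where
  kδ+mv≡mv′ : k * δ + m * v ≡ m * v′
  kδ+mv≡mv′ = +-cancelˡ-≡ (k * u′) _ _ (begin
    k * u′ + (k * δ + m * v) ≡⟨ solve (k ∷ u′ ∷ δ ∷ m ∷ v ∷ []) ⟩
    k * (u′ + δ) + m * v     ≡⟨ eq ⟩
    k * u′ + m * v′          ∎)
    where open ≡-Reasoning
  kδ≡[v′∸v]m : k * δ ≡ (v′ ∸ v) * m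
  kδ≡[v′∸v]m = begin
    k * δ                  ≡⟨ m+n∸n≡m (k * δ) (m * v) ⟨
    k * δ + m * v ∸ m * v  ≡⟨ cong (_∸ m * v) kδ+mv≡mv′ ⟩
    m * v′ ∸ m * v         ≡⟨ *-distribˡ-∸ m v′ v ⟨
    m * (v′ ∸ v)           ≡⟨ *-comm m (v′ ∸ v) ⟩
    (v′ ∸ v) * m           ∎
    where open ≡-Reasoning
... | divides p δ≡pm = p , cong (u′ +_) δ≡pm

coprime-cancel : Coprime m k → k * u + m * v ≡ k * u′ + m * v′ → Congruent m u u′
coprime-cancel {u = u} {u′ = u′} m⊥k eq with ≤-total u′ u
... | inj₁ u′≤u = let p , e = coprime-cancel-≤ m⊥k u′≤u eq in
  p , 0 , inj₂ refl , trans (+-identityʳ u) e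
... | inj₂ u≤u′ = let p , e = coprime-cancel-≤ m⊥k u≤u′ (sym eq) in
  0 , p , inj₁ refl , trans (sym e) (sym (+-identityʳ u′))

coprime-congruent : ∀ c t → Coprime m k → k * u + m * v ≡ c * l → k * u′ + m * v′ ≡ c * l′ →
                    l ≡ t * m + l′ → Congruent m u u′
coprime-congruent {m} {k} {u} {v} {l} {u′} {v′} {l′} c t m⊥k e e′ l≡ = coprime-cancel m⊥k (begin
  k * u + m * v                   ≡⟨ e ⟩
  c * l                           ≡⟨ cong (c *_) l≡ ⟩
  c * (t * m + l′)                ≡⟨ solve (c ∷ t ∷ m ∷ l′ ∷ []) ⟩
  c * l′ + m * (c * t)            ≡⟨ cong (_+ m * (c * t)) e′ ⟨
  k * u′ + m * v′ + m * (c * t)   ≡⟨ solve (k ∷ u′ ∷ m ∷ v′ ∷ c ∷ t ∷ []) ⟩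
  k * u′ + m * (v′ + c * t)       ∎)
  where open ≡-Reasoning

adjugate-cancel : ∀ m c r a a′ b b′ .{{_ : NonZero m}} →
  c * P₁ ≡ r * Q₁ + m * y → c * P₂ ≡ r * Q₂ + m * y′ →
  P₁ + a * m ≡ P₂ + a′ * m → Q₁ + b * m ≡ Q₂ + b′ * m →
  a * c + b′ * r + y ≡ a′ * c + b * r + y′
adjugate-cancel {P₁} {Q₁} {y} {P₂} {Q₂} {y′} m c r a a′ b b′ adj₁ adj₂ P≅ Q≅ =
  *-cancelˡ-≡ _ _ m (+-cancelʳ-≡ (r * (Q₁ + Q₂)) _ _ (begin
    m * (a * c + b′ * r + y) + r * (Q₁ + Q₂)
      ≡⟨ solve (m ∷ a ∷ c ∷ b′ ∷ r ∷ y ∷ Q₁ ∷ Q₂ ∷ []) ⟩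
    c * (a * m) + r * (Q₂ + b′ * m) + (r * Q₁ + m * y)
      ≡⟨ cong (c * (a * m) + r * (Q₂ + b′ * m) +_) adj₁ ⟨
    c * (a * m) + r * (Q₂ + b′ * m) + c * P₁
      ≡⟨ solve (c ∷ a ∷ m ∷ r ∷ Q₂ ∷ b′ ∷ P₁ ∷ []) ⟩
    c * (P₁ + a * m) + r * (Q₂ + b′ * m)
      ≡⟨ cong₂ (λ p q → c * p + r * q) P≅ (sym Q≅) ⟩
    c * (P₂ + a′ * m) + r * (Q₁ + b * m)
      ≡⟨ solve (c ∷ a′ ∷ m ∷ r ∷ Q₁ ∷ b ∷ P₂ ∷ []) ⟩
    c * (a′ * m) + r * (Q₁ + b * m) + c * P₂
      ≡⟨ cong (c * (a′ * m) + r * (Q₁ + b * m) +_) adj₂ ⟩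
    c * (a′ * m) + r * (Q₁ + b * m) + (r * Q₂ + m * y′)
      ≡⟨ solve (m ∷ a′ ∷ c ∷ b ∷ r ∷ y′ ∷ Q₁ ∷ Q₂ ∷ []) ⟩
    m * (a′ * c + b * r + y′) + r * (Q₁ + Q₂) ∎))
  where open ≡-Reasoning

≤-of-positive-multiple : ∀ a s {k y y′} → y ≡ suc a * s + k + y′ → s ≤ y
≤-of-positive-multiple a s {k} {y′ = y′} refl = begin
  s                  ≤⟨ m≤m+n s (a * s) ⟩
  suc a * s          ≤⟨ m≤m+n _ k ⟩
  suc a * s + k      ≤⟨ m≤m+n _ y′ ⟩
  suc a * s + k + y′ ∎
  where open ≤-Reasoning

≤-of-equal-multiples : ∀ a r s {k y y′} → suc a * r + y ≡ suc a * (s + r) + k + y′ → s ≤ y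
≤-of-equal-multiples a r s {k} {y′ = y′} e =
  ≤-of-positive-multiple a s {k} {y′ = y′}
    (+-cancelˡ-≡ (suc a * r) _ _ (trans e (solve (a ∷ r ∷ s ∷ k ∷ y′ ∷ []))))

≤-of-larger-multiple : ∀ a b r s {k y y′} → a < b → a * r + y ≡ b * (s + r) + k + y′ → s + r ≤ y
≤-of-larger-multiple a b r s {k} {y} {y′} a<b e with m≤n⇒∃[o]m+o≡n a<b
... | δ , refl = begin
  s + r                                    ≤⟨ +-mono-≤ (m≤m+n s ((a + δ) * s)) (m≤m+n r (δ * r)) ⟩
  suc (a + δ) * s + suc δ * r              ≤⟨ m≤m+n _ k ⟩
  suc (a + δ) * s + suc δ * r + k          ≤⟨ m≤m+n _ y′ ⟩
  suc (a + δ) * s + suc δ * r + k + y′     ≡⟨ +-cancelˡ-≡ (a * r) _ _ (trans e (solve (a ∷ δ ∷ r ∷ s ∷ k ∷ y′ ∷ []))) ⟨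
  y                                        ∎
  where open ≤-Reasoning

∸-generator-∈⇔ : ∀ {a₁ a₂ a₃ s} → (a₁ ≤ s × InSemigroup3 a₁ a₂ a₃ (s ∸ a₁)) ⇔
                 (∃ λ x → ∃ λ y → ∃ λ z → s ≡ suc x * a₁ + (y * a₂ + z * a₃))
∸-generator-∈⇔ {a₁} {a₂} {a₃} {s} = mk⇔ to from
  where
  to : a₁ ≤ s × InSemigroup3 a₁ a₂ a₃ (s ∸ a₁) → ∃ λ x → ∃ λ y → ∃ λ z → s ≡ suc x * a₁ + (y * a₂ + z * a₃)
  to (a₁≤s , x , y , z , e) = x , y , z , (begin
    s                                  ≡⟨ m+[n∸m]≡n a₁≤s ⟨
    a₁ + (s ∸ a₁)                      ≡⟨ cong (a₁ +_) e ⟩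
    a₁ + (x * a₁ + y * a₂ + z * a₃)    ≡⟨ solve (x ∷ y ∷ z ∷ a₁ ∷ a₂ ∷ a₃ ∷ []) ⟩
    suc x * a₁ + (y * a₂ + z * a₃)     ∎)
    where open ≡-Reasoning
  from : (∃ λ x → ∃ λ y → ∃ λ z → s ≡ suc x * a₁ + (y * a₂ + z * a₃)) → a₁ ≤ s × InSemigroup3 a₁ a₂ a₃ (s ∸ a₁)
  from (x , y , z , refl) = ≤-trans (m≤m+n a₁ (x * a₁)) (m≤m+n _ _) , x , y , z , (begin
    a₁ + x * a₁ + (y * a₂ + z * a₃) ∸ a₁    ≡⟨ cong (_∸ a₁) (+-assoc a₁ _ _) ⟩
    a₁ + (x * a₁ + (y * a₂ + z * a₃)) ∸ a₁  ≡⟨ m+n∸m≡n a₁ _ ⟩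
    x * a₁ + (y * a₂ + z * a₃)              ≡⟨ +-assoc (x * a₁) _ _ ⟨
    x * a₁ + y * a₂ + z * a₃                ∎)
    where open ≡-Reasoning

module LShapedApery
  (A B C r₁₂ r₁₃ r₂₁ r₂₃ r₃₁ r₃₂ : ℕ) .{{_ : NonZero A}}
  (rel₂ : (r₁₂ + r₃₂) * B ≡ r₂₁ * A + r₂₃ * C)
  (rel₃ : (r₁₃ + r₂₃) * C ≡ r₃₁ * A + r₃₂ * B)
  (det : (r₁₂ + r₃₂) * (r₁₃ + r₂₃) ≡ A + r₂₃ * r₃₂)
  (0<r₂₁ : 0 < r₂₁) (0<r₃₁ : 0 < r₃₁)
  (A⊥B : Coprime A B) (A⊥C : Coprime A C)
  where

  InL : ℕ → ℕ → Set
  InL y z = y < r₁₂ + r₃₂ × z < r₁₃ + r₂₃ × ¬ (r₁₂ ≤ y × r₁₃ ≤ z)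

  LForm : ℕ → Set
  LForm s = ∃ λ x → ∃ λ y → ∃ λ z → InL y z × s ≡ x * A + (y * B + z * C)

  rel₁ : r₁₂ * B + r₁₃ * C ≡ (r₂₁ + r₃₁) * A
  rel₁ = +-cancelʳ-≡ (r₃₂ * B + r₂₃ * C) _ _ (begin
    r₁₂ * B + r₁₃ * C + (r₃₂ * B + r₂₃ * C)  ≡⟨ solve (r₁₂ ∷ r₁₃ ∷ r₂₃ ∷ r₃₂ ∷ B ∷ C ∷ []) ⟩
    (r₁₂ + r₃₂) * B + (r₁₃ + r₂₃) * C        ≡⟨ cong₂ _+_ rel₂ rel₃ ⟩
    r₂₁ * A + r₂₃ * C + (r₃₁ * A + r₃₂ * B)  ≡⟨ solve (r₂₁ ∷ r₃₁ ∷ r₂₃ ∷ r₃₂ ∷ A ∷ B ∷ C ∷ []) ⟩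
    (r₂₁ + r₃₁) * A + (r₃₂ * B + r₂₃ * C)    ∎)
    where open ≡-Reasoning

  move₁ : ∀ y z → (r₁₂ + y) * B + (r₁₃ + z) * C ≡ (r₂₁ + r₃₁) * A + (y * B + z * C)
  move₁ y z = begin
    (r₁₂ + y) * B + (r₁₃ + z) * C       ≡⟨ solve (r₁₂ ∷ r₁₃ ∷ y ∷ z ∷ B ∷ C ∷ []) ⟩
    r₁₂ * B + r₁₃ * C + (y * B + z * C) ≡⟨ cong (_+ (y * B + z * C)) rel₁ ⟩
    (r₂₁ + r₃₁) * A + (y * B + z * C)   ∎
    where open ≡-Reasoning

  move₂ : ∀ y z → (r₁₂ + r₃₂ + y) * B + z * C ≡ r₂₁ * A + (y * B + (r₂₃ + z) * C)
  move₂ y z = begin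
    (r₁₂ + r₃₂ + y) * B + z * C         ≡⟨ solve (r₁₂ ∷ r₃₂ ∷ y ∷ z ∷ B ∷ C ∷ []) ⟩
    (r₁₂ + r₃₂) * B + (y * B + z * C)   ≡⟨ cong (_+ (y * B + z * C)) rel₂ ⟩
    r₂₁ * A + r₂₃ * C + (y * B + z * C) ≡⟨ solve (r₂₁ ∷ r₂₃ ∷ y ∷ z ∷ A ∷ B ∷ C ∷ []) ⟩
    r₂₁ * A + (y * B + (r₂₃ + z) * C)   ∎
    where open ≡-Reasoning

  move₃ : ∀ y z → y * B + (r₁₃ + r₂₃ + z) * C ≡ r₃₁ * A + ((r₃₂ + y) * B + z * C)
  move₃ y z = begin
    y * B + (r₁₃ + r₂₃ + z) * C         ≡⟨ solve (r₁₃ ∷ r₂₃ ∷ y ∷ z ∷ B ∷ C ∷ []) ⟩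
    (r₁₃ + r₂₃) * C + (y * B + z * C)   ≡⟨ cong (_+ (y * B + z * C)) rel₃ ⟩
    r₃₁ * A + r₃₂ * B + (y * B + z * C) ≡⟨ solve (r₃₁ ∷ r₃₂ ∷ y ∷ z ∷ A ∷ B ∷ C ∷ []) ⟩
    r₃₁ * A + ((r₃₂ + y) * B + z * C)   ∎
    where open ≡-Reasoning

  LForm-add : ∀ a {s} → LForm s → LForm (a * A + s)
  LForm-add a {s} (x , y , z , inL , s≡) = a + x , y , z , inL , (begin
    a * A + s                         ≡⟨ cong (a * A +_) s≡ ⟩
    a * A + (x * A + (y * B + z * C)) ≡⟨ solve (a ∷ x ∷ y ∷ z ∷ A ∷ B ∷ C ∷ []) ⟩
    (a + x) * A + (y * B + z * C)     ∎)
    where open ≡-Reasoning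

  descend : ∀ {s s′} a → 0 < a → s ≡ a * A + s′ → (s′ < s → LForm s′) → LForm s
  descend {s} {s′} a 0<a s≡ recurse = subst LForm (sym s≡) (LForm-add a (recurse s′<s))
    where
    s′<s : s′ < s
    s′<s = subst (s′ <_) (sym s≡) (m<n+m s′ (*-mono-≤ 0<a (>-nonZero⁻¹ A)))

  reduce-to-L : ∀ y z → Acc _<_ (y * B + z * C) → LForm (y * B + z * C)
  reduce-to-L y z (acc rec) with r₁₂ + r₃₂ ≤? y | r₁₃ + r₂₃ ≤? z
  ... | yes c₂≤y | _ with m≤n⇒∃[o]m+o≡n c₂≤y
  ...   | y₁ , refl = descend r₂₁ 0<r₂₁ (move₂ y₁ z) (λ lt → reduce-to-L y₁ (r₂₃ + z) (rec lt))
  reduce-to-L y z (acc rec) | no c₂≰y | yes c₃≤z with m≤n⇒∃[o]m+o≡n c₃≤z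
  ...   | z₁ , refl = descend r₃₁ 0<r₃₁ (move₃ y z₁) (λ lt → reduce-to-L (r₃₂ + y) z₁ (rec lt))
  reduce-to-L y z (acc rec) | no c₂≰y | no c₃≰z with r₁₂ ≤? y ×-dec r₁₃ ≤? z
  ... | no ¬corner = 0 , y , z , (≰⇒> c₂≰y , ≰⇒> c₃≰z , ¬corner) , refl
  ... | yes (r₁₂≤y , r₁₃≤z) with m≤n⇒∃[o]m+o≡n r₁₂≤y | m≤n⇒∃[o]m+o≡n r₁₃≤z
  ...   | y₁ , refl | z₁ , refl =
    descend (r₂₁ + r₃₁) (≤-trans 0<r₂₁ (m≤m+n r₂₁ r₃₁)) (move₁ y₁ z₁) (λ lt → reduce-to-L y₁ z₁ (rec lt))

  ∈⇒LForm : ∀ {s} → InSemigroup3 A B C s → LForm s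
  ∈⇒LForm (x , y , z , refl) =
    subst LForm (sym (+-assoc (x * A) (y * B) (z * C))) (LForm-add x (reduce-to-L y z (<-wellFounded _)))

  -- A times the coordinates of (y, z) in the basis (c₂, −r₂₃), (−r₃₂, c₃).
  P Q : ℕ → ℕ → ℕ
  P y z = y * (r₁₃ + r₂₃) + z * r₃₂
  Q y z = y * r₂₃ + z * (r₁₂ + r₃₂)

  P-weighted : ∀ y z → B * P y z + A * (r₃₁ * z) ≡ (r₁₃ + r₂₃) * (y * B + z * C)
  P-weighted y z = begin
    B * (y * (r₁₃ + r₂₃) + z * r₃₂) + A * (r₃₁ * z)   ≡⟨ solve (r₁₃ ∷ r₂₃ ∷ r₃₁ ∷ r₃₂ ∷ y ∷ z ∷ A ∷ B ∷ []) ⟩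
    (r₁₃ + r₂₃) * (y * B) + z * (r₃₁ * A + r₃₂ * B)   ≡⟨ cong (λ w → (r₁₃ + r₂₃) * (y * B) + z * w) rel₃ ⟨
    (r₁₃ + r₂₃) * (y * B) + z * ((r₁₃ + r₂₃) * C)     ≡⟨ solve (r₁₃ ∷ r₂₃ ∷ y ∷ z ∷ B ∷ C ∷ []) ⟩
    (r₁₃ + r₂₃) * (y * B + z * C)                     ∎
    where open ≡-Reasoning

  Q-weighted : ∀ y z → C * Q y z + A * (r₂₁ * y) ≡ (r₁₂ + r₃₂) * (y * B + z * C)
  Q-weighted y z = begin
    C * (y * r₂₃ + z * (r₁₂ + r₃₂)) + A * (r₂₁ * y)   ≡⟨ solve (r₁₂ ∷ r₂₁ ∷ r₂₃ ∷ r₃₂ ∷ y ∷ z ∷ A ∷ C ∷ []) ⟩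
    y * (r₂₁ * A + r₂₃ * C) + (r₁₂ + r₃₂) * (z * C)   ≡⟨ cong (λ w → y * w + (r₁₂ + r₃₂) * (z * C)) rel₂ ⟨
    y * ((r₁₂ + r₃₂) * B) + (r₁₂ + r₃₂) * (z * C)     ≡⟨ solve (r₁₂ ∷ r₃₂ ∷ y ∷ z ∷ B ∷ C ∷ []) ⟩
    (r₁₂ + r₃₂) * (y * B + z * C)                     ∎
    where open ≡-Reasoning

  P-adjugate : ∀ y z → (r₁₂ + r₃₂) * P y z ≡ r₃₂ * Q y z + A * y
  P-adjugate y z = begin
    (r₁₂ + r₃₂) * (y * (r₁₃ + r₂₃) + z * r₃₂)          ≡⟨ solve (r₁₂ ∷ r₁₃ ∷ r₂₃ ∷ r₃₂ ∷ y ∷ z ∷ []) ⟩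
    y * ((r₁₂ + r₃₂) * (r₁₃ + r₂₃)) + r₃₂ * (z * (r₁₂ + r₃₂)) ≡⟨ cong (λ w → y * w + r₃₂ * (z * (r₁₂ + r₃₂))) det ⟩
    y * (A + r₂₃ * r₃₂) + r₃₂ * (z * (r₁₂ + r₃₂))      ≡⟨ solve (r₁₂ ∷ r₂₃ ∷ r₃₂ ∷ y ∷ z ∷ A ∷ []) ⟩
    r₃₂ * (y * r₂₃ + z * (r₁₂ + r₃₂)) + A * y          ∎
    where open ≡-Reasoning

  Q-adjugate : ∀ y z → (r₁₃ + r₂₃) * Q y z ≡ r₂₃ * P y z + A * z
  Q-adjugate y z = begin
    (r₁₃ + r₂₃) * (y * r₂₃ + z * (r₁₂ + r₃₂))          ≡⟨ solve (r₁₂ ∷ r₁₃ ∷ r₂₃ ∷ r₃₂ ∷ y ∷ z ∷ []) ⟩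
    r₂₃ * (y * (r₁₃ + r₂₃)) + z * ((r₁₂ + r₃₂) * (r₁₃ + r₂₃)) ≡⟨ cong (λ w → r₂₃ * (y * (r₁₃ + r₂₃)) + z * w) det ⟩
    r₂₃ * (y * (r₁₃ + r₂₃)) + z * (A + r₂₃ * r₃₂)      ≡⟨ solve (r₁₃ ∷ r₂₃ ∷ r₃₂ ∷ y ∷ z ∷ A ∷ []) ⟩
    r₂₃ * (y * (r₁₃ + r₂₃) + z * r₃₂) + A * z          ∎
    where open ≡-Reasoning

  lattice-translate : ∀ a a′ b b′ y z →
    (a * (r₁₂ + r₃₂) + b′ * r₃₂ + y) * B + (b * (r₁₃ + r₂₃) + a′ * r₂₃ + z) * C
      ≡ (a * r₂₁ + b * r₃₁) * A + (y * B + z * C) + ((a + a′) * r₂₃ * C + (b + b′) * r₃₂ * B)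
  lattice-translate a a′ b b′ y z = begin
    (a * (r₁₂ + r₃₂) + b′ * r₃₂ + y) * B + (b * (r₁₃ + r₂₃) + a′ * r₂₃ + z) * C
      ≡⟨ solve (a ∷ a′ ∷ b ∷ b′ ∷ r₁₂ ∷ r₁₃ ∷ r₂₃ ∷ r₃₂ ∷ y ∷ z ∷ B ∷ C ∷ []) ⟩
    a * ((r₁₂ + r₃₂) * B) + b * ((r₁₃ + r₂₃) * C) + (y * B + z * C) + (a′ * r₂₃ * C + b′ * r₃₂ * B)
      ≡⟨ cong₂ (λ p q → a * p + b * q + (y * B + z * C) + (a′ * r₂₃ * C + b′ * r₃₂ * B)) rel₂ rel₃ ⟩
    a * (r₂₁ * A + r₂₃ * C) + b * (r₃₁ * A + r₃₂ * B) + (y * B + z * C) + (a′ * r₂₃ * C + b′ * r₃₂ * B)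
      ≡⟨ solve (a ∷ a′ ∷ b ∷ b′ ∷ r₂₁ ∷ r₂₃ ∷ r₃₁ ∷ r₃₂ ∷ y ∷ z ∷ A ∷ B ∷ C ∷ []) ⟩
    (a * r₂₁ + b * r₃₁) * A + (y * B + z * C) + ((a + a′) * r₂₃ * C + (b + b′) * r₃₂ * B) ∎
    where open ≡-Reasoning

  multipliers-increase : ∀ p⁺ p⁻ q⁺ q⁻ {t y z y′ z′} →
    y * B + z * C ≡ suc t * A + (y′ * B + z′ * C) →
    p⁻ * (r₁₂ + r₃₂) + q⁺ * r₃₂ + y ≡ p⁺ * (r₁₂ + r₃₂) + q⁻ * r₃₂ + y′ →
    q⁻ * (r₁₃ + r₂₃) + p⁺ * r₂₃ + z ≡ q⁺ * (r₁₃ + r₂₃) + p⁻ * r₂₃ + z′ →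
    p⁻ * r₂₁ + q⁻ * r₃₁ < p⁺ * r₂₁ + q⁺ * r₃₁
  multipliers-increase p⁺ p⁻ q⁺ q⁻ {t} {y} {z} {y′} {z′} e Ey Ez =
    subst (p⁻ * r₂₁ + q⁻ * r₃₁ <_) balance (m<m+n _ z<s)
    where
    open ≡-Reasoning
    balance : p⁻ * r₂₁ + q⁻ * r₃₁ + suc t ≡ p⁺ * r₂₁ + q⁺ * r₃₁
    balance = *-cancelʳ-≡ _ _ A
      (+-cancelʳ-≡ (y′ * B + z′ * C + ((p⁻ + p⁺) * r₂₃ * C + (q⁻ + q⁺) * r₃₂ * B)) _ _ (begin
      (p⁻ * r₂₁ + q⁻ * r₃₁ + suc t) * A + (y′ * B + z′ * C + ((p⁻ + p⁺) * r₂₃ * C + (q⁻ + q⁺) * r₃₂ * B))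
        ≡⟨ solve (t ∷ p⁻ ∷ p⁺ ∷ q⁻ ∷ q⁺ ∷ r₂₁ ∷ r₂₃ ∷ r₃₁ ∷ r₃₂ ∷ y′ ∷ z′ ∷ A ∷ B ∷ C ∷ []) ⟩
      (p⁻ * r₂₁ + q⁻ * r₃₁) * A + (suc t * A + (y′ * B + z′ * C)) + ((p⁻ + p⁺) * r₂₃ * C + (q⁻ + q⁺) * r₃₂ * B)
        ≡⟨ cong (λ w → (p⁻ * r₂₁ + q⁻ * r₃₁) * A + w + ((p⁻ + p⁺) * r₂₃ * C + (q⁻ + q⁺) * r₃₂ * B)) e ⟨
      (p⁻ * r₂₁ + q⁻ * r₃₁) * A + (y * B + z * C) + ((p⁻ + p⁺) * r₂₃ * C + (q⁻ + q⁺) * r₃₂ * B)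
        ≡⟨ lattice-translate p⁻ p⁺ q⁻ q⁺ y z ⟨
      (p⁻ * (r₁₂ + r₃₂) + q⁺ * r₃₂ + y) * B + (q⁻ * (r₁₃ + r₂₃) + p⁺ * r₂₃ + z) * C
        ≡⟨ cong₂ (λ p q → p * B + q * C) Ey Ez ⟩
      (p⁺ * (r₁₂ + r₃₂) + q⁻ * r₃₂ + y′) * B + (q⁺ * (r₁₃ + r₂₃) + p⁻ * r₂₃ + z′) * C
        ≡⟨ lattice-translate p⁺ p⁻ q⁺ q⁻ y′ z′ ⟩
      (p⁺ * r₂₁ + q⁺ * r₃₁) * A + (y′ * B + z′ * C) + ((p⁺ + p⁻) * r₂₃ * C + (q⁺ + q⁻) * r₃₂ * B)
        ≡⟨ solve (p⁻ ∷ p⁺ ∷ q⁻ ∷ q⁺ ∷ r₂₁ ∷ r₂₃ ∷ r₃₁ ∷ r₃₂ ∷ y′ ∷ z′ ∷ A ∷ B ∷ C ∷ []) ⟩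
      (p⁺ * r₂₁ + q⁺ * r₃₁) * A + (y′ * B + z′ * C + ((p⁻ + p⁺) * r₂₃ * C + (q⁻ + q⁺) * r₃₂ * B)) ∎))

  no-descent-from-L : ∀ p⁺ p⁻ q⁺ q⁻ {y z y′ z′} → InL y z → p⁺ ≡ 0 ⊎ p⁻ ≡ 0 → q⁺ ≡ 0 ⊎ q⁻ ≡ 0 →
    p⁻ * (r₁₂ + r₃₂) + q⁺ * r₃₂ + y ≡ p⁺ * (r₁₂ + r₃₂) + q⁻ * r₃₂ + y′ →
    q⁻ * (r₁₃ + r₂₃) + p⁺ * r₂₃ + z ≡ q⁺ * (r₁₃ + r₂₃) + p⁻ * r₂₃ + z′ →
    p⁻ * r₂₁ + q⁻ * r₃₁ < p⁺ * r₂₁ + q⁺ * r₃₁ → ⊥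
  no-descent-from-L zero    _ zero    _ _ _ _ _ _ ()
  no-descent-from-L zero    _ (suc b) _ _ _ (inj₁ ()) _ _ _
  no-descent-from-L zero    _ (suc b) _ (_ , z<c₃ , _) _ (inj₂ refl) _ Ez _ =
    <⇒≱ z<c₃ (≤-of-positive-multiple b (r₁₃ + r₂₃) Ez)
  no-descent-from-L (suc a) _ zero    _ _ (inj₁ ()) _ _ _ _
  no-descent-from-L (suc a) _ zero    _ (y<c₂ , _) (inj₂ refl) _ Ey _ _ =
    <⇒≱ y<c₂ (≤-of-positive-multiple a (r₁₂ + r₃₂) Ey)
  no-descent-from-L (suc a) _ (suc b) _ _ (inj₁ ()) _ _ _ _
  no-descent-from-L (suc a) _ (suc b) _ _ (inj₂ refl) (inj₁ ()) _ _ _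
  no-descent-from-L (suc a) _ (suc b) _ (y<c₂ , z<c₃ , ¬corner) (inj₂ refl) (inj₂ refl) Ey Ez _
    with <-cmp a b
  ... | tri< a<b _ _ = <⇒≱ z<c₃ (≤-of-larger-multiple (suc a) (suc b) r₂₃ r₁₃ (s<s a<b) Ez)
  ... | tri≈ _ refl _ = ¬corner (≤-of-equal-multiples a r₃₂ r₁₂ Ey , ≤-of-equal-multiples a r₂₃ r₁₃ Ez)
  ... | tri> _ _ b<a = <⇒≱ y<c₂ (≤-of-larger-multiple (suc b) (suc a) r₃₂ r₁₂ (s<s b<a) Ey)

  InL⇒minimal : ∀ {t y z y′ z′} → InL y z → y * B + z * C ≢ suc t * A + (y′ * B + z′ * C)
  InL⇒minimal {t} {y} {z} {y′} {z′} inL e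
    with coprime-congruent (r₁₃ + r₂₃) (suc t) A⊥B (P-weighted y z) (P-weighted y′ z′) e
       | coprime-congruent (r₁₂ + r₃₂) (suc t) A⊥C (Q-weighted y z) (Q-weighted y′ z′) e
  ... | p⁺ , p⁻ , p-normal , P≅ | q⁺ , q⁻ , q-normal , Q≅ =
    no-descent-from-L p⁺ p⁻ q⁺ q⁻ inL p-normal q-normal Ey Ez
      (multipliers-increase p⁺ p⁻ q⁺ q⁻ {t} e Ey Ez)
    where
    Ey : p⁻ * (r₁₂ + r₃₂) + q⁺ * r₃₂ + y ≡ p⁺ * (r₁₂ + r₃₂) + q⁻ * r₃₂ + y′
    Ey = adjugate-cancel A (r₁₂ + r₃₂) r₃₂ p⁻ p⁺ q⁻ q⁺ (P-adjugate y z) (P-adjugate y′ z′) P≅ Q≅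
    Ez : q⁻ * (r₁₃ + r₂₃) + p⁺ * r₂₃ + z ≡ q⁺ * (r₁₃ + r₂₃) + p⁻ * r₂₃ + z′
    Ez = adjugate-cancel A (r₁₃ + r₂₃) r₂₃ q⁻ q⁺ p⁻ p⁺ (Q-adjugate y z) (Q-adjugate y′ z′) Q≅ P≅

  apery-set : ∀ s → InApery3 A B C A s ⇔ (∃ λ y → ∃ λ z → InL y z × s ≡ y * B + z * C)
  apery-set s = mk⇔ to from
    where
    to : InApery3 A B C A s → ∃ λ y → ∃ λ z → InL y z × s ≡ y * B + z * C
    to (s∈S , s∸A∉S) with ∈⇒LForm s∈S
    ... | zero  , y , z , inL , s≡ = y , z , inL , s≡
    ... | suc x , y , z , _   , s≡ = ⊥-elim (s∸A∉S (Equivalence.from ∸-generator-∈⇔ (x , y , z , s≡)))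
    from : (∃ λ y → ∃ λ z → InL y z × s ≡ y * B + z * C) → InApery3 A B C A s
    from (y , z , inL , s≡) = (0 , y , z , s≡) , λ s∸A∈S →
      let x , y′ , z′ , s≡′ = Equivalence.to ∸-generator-∈⇔ s∸A∈S in
      InL⇒minimal {x} {y′ = y′} {z′} inL (trans (sym s≡) s≡′)

InRange-0⇔< : 0 < m → InRange 0 (m ∸ 1) y ⇔ y < m
InRange-0⇔< {suc m} _ = mk⇔ (λ (_ , y≤m) → s≤s y≤m) (λ { (s≤s y≤m) → z≤n , y≤m })

L-shape⇔ranges : ∀ {B C c₂ c₃ r₁₂ r₁₃ X₂ X₃ Y₂ Y₃ s} → 0 < c₂ → 0 < c₃ →
  X₂ ≡ c₂ → X₃ ≡ c₃ → Y₂ ≡ r₁₂ → Y₃ ≡ r₁₃ →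
  (∃ λ y → ∃ λ z → (y < c₂ × z < c₃ × ¬ (r₁₂ ≤ y × r₁₃ ≤ z)) × s ≡ y * B + z * C) ⇔
  (∃ λ y → ∃ λ z → (InRange 0 (X₂ ∸ 1) y × InRange 0 (X₃ ∸ 1) z)
                   × ¬ (InRange Y₂ (X₂ ∸ 1) y × InRange Y₃ (X₃ ∸ 1) z)
                   × s ≡ y * B + z * C)
L-shape⇔ranges 0<c₂ 0<c₃ refl refl refl refl = mk⇔
  (λ (y , z , (y<c₂ , z<c₃ , ¬corner) , s≡) →
    y , z , (from (InRange-0⇔< 0<c₂) y<c₂ , from (InRange-0⇔< 0<c₃) z<c₃) ,
    (λ ((r₁₂≤y , _) , (r₁₃≤z , _)) → ¬corner (r₁₂≤y , r₁₃≤z)) , s≡)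
  (λ (y , z , (y∈ , z∈) , ¬corner , s≡) →
    y , z , (to (InRange-0⇔< 0<c₂) y∈ , to (InRange-0⇔< 0<c₃) z∈ ,
    λ (r₁₂≤y , r₁₃≤z) → ¬corner ((r₁₂≤y , proj₂ y∈) , (r₁₃≤z , proj₂ z∈))) , s≡)
  where open Equivalence

coprime-*ʳ : Coprime m k → Coprime m c → Coprime m (k * c)
coprime-*ʳ {m} {k} m⊥k m⊥c (i∣m , i∣kc) = m⊥c (i∣m , coprime-divisor i⊥k i∣kc)
  where
  i⊥k : Coprime _ k
  i⊥k (j∣i , j∣k) = m⊥k (∣-trans j∣i i∣m , j∣k)

coprime-sq : Coprime m k → Coprime (sq m) (sq k)
coprime-sq m⊥k = coprime-sym (coprime-*ʳ k²⊥m k²⊥m)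
  where k²⊥m = coprime-sym (coprime-*ʳ m⊥k m⊥k)

halve : ∀ c → m ≡ c + c → ⌊ m /2⌋ ≡ c
halve c refl = sym (n≡⌊n+n/2⌋ c)

apery-window : ∀ {f₋₂ f₋₁ f₀ f₁ f₂} → 0 < f₋₂ → 2 ∣ f₋₁ →
  f₀ ≡ f₋₁ + f₋₂ → f₁ ≡ f₀ + f₋₁ → f₂ ≡ f₁ + f₀ → Coprime f₀ f₁ → ∀ s →
  InApery3 (sq f₀) (sq f₁) (sq f₂) (sq f₀) s ⇔
  (∃ λ l → ∃ λ m →
     (InRange 0 (⌊ f₂ /2⌋ ∸ 1) l × InRange 0 (f₀ ∸ 1) m)
     × ¬ (InRange ⌊ f₋₁ /2⌋ (⌊ f₂ /2⌋ ∸ 1) l × InRange ⌊ f₋₂ + f₀ /2⌋ (f₀ ∸ 1) m)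
     × s ≡ l * sq f₁ + m * sq f₂)
apery-window {d} {f₀ = f₀} {f₁} {f₂} 0<d (divides h refl) refl refl refl f₀⊥f₁ s =
  L-shape⇔ranges 0<h+f₀ 0<d+h+h (halve (h + f₀) f₂≡) f₀≡ (halve h h*2≡) (halve (d + h) d+f₀≡)
  ⇔-∘ apery-set s
  where
  rel₂ : (h + f₀) * (f₁ * f₁) ≡ (h + f₀) * (f₀ * f₀) + h * (f₂ * f₂)
  rel₂ = solve (d ∷ h ∷ [])
  rel₃ : (d + h + h) * (f₂ * f₂) ≡ (f₁ + f₂) * (f₀ * f₀) + f₀ * (f₁ * f₁)
  rel₃ = solve (d ∷ h ∷ [])
  det : (h + f₀) * (d + h + h) ≡ f₀ * f₀ + h * f₀
  det = solve (d ∷ h ∷ [])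
  f₂≡ : f₂ ≡ h + f₀ + (h + f₀)
  f₂≡ = solve (d ∷ h ∷ [])
  f₀≡ : f₀ ≡ d + h + h
  f₀≡ = solve (d ∷ h ∷ [])
  h*2≡ : h * 2 ≡ h + h
  h*2≡ = solve (h ∷ [])
  d+f₀≡ : d + f₀ ≡ d + h + (d + h)
  d+f₀≡ = solve (d ∷ h ∷ [])
  0<f₀ : 0 < f₀
  0<f₀ = ≤-trans 0<d (m≤n+m d (h * 2))
  0<h+f₀ : 0 < h + f₀
  0<h+f₀ = ≤-trans 0<f₀ (m≤n+m f₀ h)
  0<d+h+h : 0 < d + h + h
  0<d+h+h = ≤-trans 0<d (≤-trans (m≤m+n d h) (m≤m+n (d + h) h))
  0<f₁+f₂ : 0 < f₁ + f₂
  0<f₁+f₂ = ≤-trans 0<f₀ (≤-trans (m≤m+n f₀ (h * 2)) (m≤m+n f₁ f₂))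
  f₀⊥f₂ : Coprime f₀ f₂
  f₀⊥f₂ = subst (Coprime f₀) (+-comm f₀ f₁) (coprime-sym (coprime-+ (coprime-sym f₀⊥f₁)))
  open LShapedApery (sq f₀) (sq f₁) (sq f₂) h (d + h) (h + f₀) h (f₁ + f₂) f₀
    {{m*n≢0 f₀ f₀ {{>-nonZero 0<f₀}} {{>-nonZero 0<f₀}}}}
    rel₂ rel₃ det 0<h+f₀ 0<f₁+f₂ (coprime-sq f₀⊥f₁) (coprime-sq f₀⊥f₂)

fib-pos : ∀ n → 0 < fib (suc n)
fib-pos zero    = z<s
fib-pos (suc n) = ≤-trans (fib-pos n) (m≤m+n (fib (suc n)) (fib n))

fib-coprime : ∀ n → Coprime (fib n) (fib (suc n))
fib-coprime zero    = coprime-sym (1-coprimeTo 0)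
fib-coprime (suc n) = coprime-sym (coprime-+ (fib-coprime n))

fib-3*-even : ∀ j → 2 ∣ fib (3 * j)
fib-3*-even zero    = 2 ∣0
fib-3*-even (suc j) = subst (λ i → 2 ∣ fib i) (sym (*-suc 3 j))
  (subst (2 ∣_) (twice+ (fib (1 + 3 * j)) (fib (3 * j)))
    (∣m∣n⇒∣m+n (m∣m*n (fib (1 + 3 * j))) (fib-3*-even j)))
  where
  twice+ : ∀ a b → 2 * a + b ≡ a + b + a
  twice+ a b = solve (a ∷ b ∷ [])

3*[2+j]∸2≡4+3*j : ∀ j → 3 * suc (suc j) ∸ 2 ≡ 4 + 3 * j
3*[2+j]∸2≡4+3*j j = cong (_∸ 2) 3*[2+j]≡2+[4+3*j]
  where
  3*[2+j]≡2+[4+3*j] : 3 * (2 + j) ≡ 2 + (4 + 3 * j)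
  3*[2+j]≡2+[4+3*j] = solve (j ∷ [])

proposition5p13 : (k : ℕ) → 2 ≤ k → (s : ℕ) →
    InApery3 (sq (fib (3 * k ∸ 2))) (sq (fib (3 * k ∸ 2 + 1))) (sq (fib (3 * k ∸ 2 + 2))) (sq (fib (3 * k ∸ 2))) s
    ⇔ (∃ λ l → ∃ λ m →
         (InRange 0 (⌊ fib (3 * k ∸ 2 + 2) /2⌋ ∸ 1) l × InRange 0 (fib (3 * k ∸ 2) ∸ 1) m)
         × ¬ (InRange (⌊ fib (3 * k ∸ 2 ∸ 1) /2⌋) (⌊ fib (3 * k ∸ 2 + 2) /2⌋ ∸ 1) l
              × InRange (⌊ fib (3 * k ∸ 2 ∸ 2) + fib (3 * k ∸ 2) /2⌋) (fib (3 * k ∸ 2) ∸ 1) m)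
         × s ≡ l * sq (fib (3 * k ∸ 2 + 1)) + m * sq (fib (3 * k ∸ 2 + 2)))
proposition5p13 1 (s≤s ())
proposition5p13 (suc (suc j)) _ s
  -- n = 4 + 3j, with n + 1 and n + 2 turned into successors so that fib unfolds definitionally
  rewrite 3*[2+j]∸2≡4+3*j j | +-comm (3 * j) 1 | +-comm (3 * j) 2 =
  apery-window (fib-pos (1 + 3 * j)) (subst (λ i → 2 ∣ fib i) (*-suc 3 j) (fib-3*-even (suc j)))
    refl refl refl (fib-coprime (4 + 3 * j)) s
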